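{- Define $g\colon\mathbb{N}\setminus\{1\}\to\mathbb{N}$ by $g(k)=5^{k/3}$ if $k\equiv 0\pmod 3$, $g(k)=9\cdot 5^{(k-4)/3}$ if $k\equiv 1\pmod 3$, and $g(k)=3\cdot 5^{(k-2)/3}$ if $k\equiv 2\pmod 3$. Then for all integers $m_1,m_2\geq 2$, we have $g(m_1)g(m_2)\geq g(m_1+m_2)$.
   Context: $\mathbb{N}$ denotes the set of positive integers. -}

module Defs where

open import Data.Nat using (ℕ; zero; suc; _+_; _*_; _∸_; _^_)
open import Data.Nat.DivMod using (_/_; _%_)

-- g k for k ≥ 2 (the paper's domain is ℕ∖{1}; k = 1 never occurs in the statement).
-- Case analysis on k mod 3; the exponents use truncated subtraction, which is
-- exact in the relevant cases (k ≡ 1 mod 3 with k ≥ 4, k ≡ 2 mod 3 with k ≥ 2).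
gAux : ℕ → ℕ → ℕ
gAux k zero = 5 ^ (k / 3)
gAux k (suc zero) = 9 * 5 ^ ((k ∸ 4) / 3)
gAux k (suc (suc _)) = 3 * 5 ^ ((k ∸ 2) / 3)

g : ℕ → ℕ
g k = gAux k (k % 3)

{-# OPTIONS --safe #-}
-- For k ≥ 2 one has g (3 + k) = 5 * g k, so shifting either argument by 3
-- multiplies both sides of g (m₁ + m₂) ≤ g m₁ * g m₂ by 5. The inequality thus
-- reduces to the nine cases 2 ≤ m₁, m₂ ≤ 4, which are checked by computation.
module Submission where

open import Defs
open import Data.Nat using (ℕ; _+_; _*_; _≤_; _≥_; zero; suc; _^_; s≤s; z≤n)
open import Data.Nat.Properties
  using (≤-refl; ≤-trans; m≤m+n; +-comm; *-comm; *-assoc; *-monoʳ-≤;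
         *-commutativeSemigroup; ≤ᵇ⇒≤; module ≤-Reasoning)
open import Data.Nat.DivMod using (_/_; _%_; m/n≡1+[m∸n]/n; m≤n⇒[n∸m]%m≡n%m)
open import Algebra.Properties.CommutativeSemigroup *-commutativeSemigroup using (x∙yz≈y∙xz)
open import Relation.Binary.PropositionalEquality using (_≡_; refl; sym; trans; cong; subst₂)
open import Data.Unit using (tt)

module ShiftedSubmultiplicativity
  (f : ℕ → ℕ) (c : ℕ) (f-+3 : ∀ k → 2 ≤ k → f (3 + k) ≡ c * f k) where

  SubmultiplicativeAt : ℕ → ℕ → Set
  SubmultiplicativeAt a b = f (a + b) ≤ f a * f b

  submultiplicativeAt-sym : ∀ a b → SubmultiplicativeAt a b → SubmultiplicativeAt b a
  submultiplicativeAt-sym a b = subst₂ _≤_ (cong f (+-comm a b)) (*-comm (f a) (f b))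

  submultiplicativeAt-+3ˡ : ∀ a b → 2 ≤ a →
                            SubmultiplicativeAt a b → SubmultiplicativeAt (3 + a) b
  submultiplicativeAt-+3ˡ a b 2≤a ih = begin
    f (3 + (a + b))   ≡⟨ f-+3 (a + b) (≤-trans 2≤a (m≤m+n a b)) ⟩
    c * f (a + b)     ≤⟨ *-monoʳ-≤ c ih ⟩
    c * (f a * f b)   ≡⟨ *-assoc c (f a) (f b) ⟨
    c * f a * f b     ≡⟨ cong (_* f b) (f-+3 a 2≤a) ⟨
    f (3 + a) * f b   ∎
    where open ≤-Reasoning

  submultiplicativeAt-+3ʳ : ∀ a b → 2 ≤ b →
                            SubmultiplicativeAt a b → SubmultiplicativeAt a (3 + b)
  submultiplicativeAt-+3ʳ a b 2≤b ih = submultiplicativeAt-sym (3 + b) a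
    (submultiplicativeAt-+3ˡ b a 2≤b (submultiplicativeAt-sym a b ih))

  module _ (box : ∀ a b → 2 ≤ a → a ≤ 4 → 2 ≤ b → b ≤ 4 → SubmultiplicativeAt a b) where

    submultiplicative-small : ∀ a b → 2 ≤ a → a ≤ 4 → 2 ≤ b → SubmultiplicativeAt a b
    submultiplicative-small _ 1 _ _ (s≤s ())
    submultiplicative-small a 2 2≤a a≤4 2≤b = box a 2 2≤a a≤4 2≤b (s≤s (s≤s z≤n))
    submultiplicative-small a 3 2≤a a≤4 2≤b = box a 3 2≤a a≤4 2≤b (s≤s (s≤s (s≤s z≤n)))
    submultiplicative-small a 4 2≤a a≤4 2≤b = box a 4 2≤a a≤4 2≤b ≤-refl
    submultiplicative-small a (suc (suc (suc b@(suc (suc _))))) 2≤a a≤4 _ =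
      submultiplicativeAt-+3ʳ a b (s≤s (s≤s z≤n))
        (submultiplicative-small a b 2≤a a≤4 (s≤s (s≤s z≤n)))

    submultiplicative : ∀ a b → 2 ≤ a → 2 ≤ b → SubmultiplicativeAt a b
    submultiplicative 1 _ (s≤s ()) _
    submultiplicative 2 b 2≤a 2≤b = submultiplicative-small 2 b 2≤a (s≤s (s≤s z≤n)) 2≤b
    submultiplicative 3 b 2≤a 2≤b = submultiplicative-small 3 b 2≤a (s≤s (s≤s (s≤s z≤n))) 2≤b
    submultiplicative 4 b 2≤a 2≤b = submultiplicative-small 4 b 2≤a ≤-refl 2≤b
    submultiplicative (suc (suc (suc a@(suc (suc _))))) b _ 2≤b =
      submultiplicativeAt-+3ˡ a b (s≤s (s≤s z≤n))
        (submultiplicative a b (s≤s (s≤s z≤n)) 2≤b)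

[3+n]/3≡1+n/3 : ∀ n → (3 + n) / 3 ≡ suc (n / 3)
[3+n]/3≡1+n/3 n = m/n≡1+[m∸n]/n (m≤m+n 3 n)

[3+n]%3≡n%3 : ∀ n → (3 + n) % 3 ≡ n % 3
[3+n]%3≡n%3 n = sym (m≤n⇒[n∸m]%m≡n%m (m≤m+n 3 n))

-- Stated from 4 on: only there does the truncated exponent (k ∸ 4) / 3 of the
-- k ≡ 1 branch shift exactly; g-+3 settles k = 2, 3 by computation.
gAux-+3 : ∀ j r → gAux (3 + (4 + j)) r ≡ 5 * gAux (4 + j) r
gAux-+3 j zero = cong (5 ^_) ([3+n]/3≡1+n/3 (4 + j))
gAux-+3 j (suc zero) =
  trans (cong (λ e → 9 * 5 ^ e) ([3+n]/3≡1+n/3 j)) (x∙yz≈y∙xz 9 5 (5 ^ (j / 3)))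
gAux-+3 j (suc (suc _)) =
  trans (cong (λ e → 3 * 5 ^ e) ([3+n]/3≡1+n/3 (2 + j))) (x∙yz≈y∙xz 3 5 (5 ^ ((2 + j) / 3)))

g-+3 : ∀ k → 2 ≤ k → g (3 + k) ≡ 5 * g k
g-+3 1 (s≤s ())
g-+3 2 _ = refl
g-+3 3 _ = refl
g-+3 k@(suc (suc (suc (suc j)))) _ =
  trans (cong (gAux (3 + k)) ([3+n]%3≡n%3 k)) (gAux-+3 j (k % 3))

g-submultiplicative-box : ∀ a b → 2 ≤ a → a ≤ 4 → 2 ≤ b → b ≤ 4 → g (a + b) ≤ g a * g b
g-submultiplicative-box 2 2 _ _ _ _ = ≤ᵇ⇒≤ _ _ tt
g-submultiplicative-box 2 3 _ _ _ _ = ≤ᵇ⇒≤ _ _ tt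
g-submultiplicative-box 2 4 _ _ _ _ = ≤ᵇ⇒≤ _ _ tt
g-submultiplicative-box 3 2 _ _ _ _ = ≤ᵇ⇒≤ _ _ tt
g-submultiplicative-box 3 3 _ _ _ _ = ≤ᵇ⇒≤ _ _ tt
g-submultiplicative-box 3 4 _ _ _ _ = ≤ᵇ⇒≤ _ _ tt
g-submultiplicative-box 4 2 _ _ _ _ = ≤ᵇ⇒≤ _ _ tt
g-submultiplicative-box 4 3 _ _ _ _ = ≤ᵇ⇒≤ _ _ tt
g-submultiplicative-box 4 4 _ _ _ _ = ≤ᵇ⇒≤ _ _ tt
g-submultiplicative-box 1 _ (s≤s ()) _ _ _
g-submultiplicative-box _ 1 _ _ (s≤s ()) _
g-submultiplicative-box (suc (suc (suc (suc (suc _))))) _ _ (s≤s (s≤s (s≤s (s≤s ())))) _ _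
g-submultiplicative-box _ (suc (suc (suc (suc (suc _))))) _ _ _ (s≤s (s≤s (s≤s (s≤s ()))))

lemma2p1 : (m₁ m₂ : ℕ) → m₁ ≥ 2 → m₂ ≥ 2 → g m₁ * g m₂ ≥ g (m₁ + m₂)
lemma2p1 = ShiftedSubmultiplicativity.submultiplicative g 5 g-+3 g-submultiplicative-box
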